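{- For every integer $n\ge1$, $\mathrm{pk}_n(123,213)=\frac12(1-\sqrt2)^n+\frac12(1+\sqrt2)^n$.
   Context: For a positive integer $n$, $[n]=\{1,\dots,n\}$. A function $f:[n]\to[n]$ is a parking function if for every $i\in[n]$, $|\{j\in[n]: f(j)\le i\}|\ge i$ (equivalently, in the usual car-parking process where car $i$ prefers spot $f(i)$ and takes the first free spot at or after it, all cars park). The parking permutation $\rho_f\in S_n$ is defined by: spot $i$ is occupied by car $\rho_f(i)$. A permutation $\pi\in S_n$ contains $\sigma\in S_m$ as a pattern if there exist $1\le i_1<\dots<i_m\le n$ with $\pi(i_a)<\pi(i_b)$ iff $\sigma(a)<\sigma(b)$ for all $a,b$; otherwise it avoids $\sigma$. $\mathrm{pk}_n(\sigma_1,\dots,\sigma_k)$ is the number of parking functions $f:[n]\to[n]$ with $\rho_f$ avoiding every $\sigma_i$. -}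

module Defs where

open import Data.Bool using (Bool; true; false; _∧_; if_then_else_; not)
open import Data.Nat using (ℕ; zero; suc; _<ᵇ_; _≤ᵇ_; _≡ᵇ_)
open import Data.Fin using (Fin; toℕ)
open import Data.List using (List; []; _∷_; map; concatMap; filter; length; allFin; zip; upTo)
open import Data.Bool.ListAction using (all; any)
open import Data.Vec using (Vec; []; _∷_; replicate; toList)
open import Data.Maybe using (Maybe; just; nothing)
open import Data.Integer using (ℤ; +_; -_) renaming (_+_ to _+ℤ_; _*_ to _*ℤ_)
open import Relation.Nullary.Decidable using (does)
open import Relation.Unary using (Decidable)
open import Data.Bool using (T)
open import Data.Bool.Properties using (T?)

_==_ : Bool → Bool → Bool
true == b = b
false == b = not b

-- Functions f : [n] → [n] are represented (0-indexed) as vectors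
-- f = (f 0, …, f (n-1)) of type Vec (Fin n) n; value k stands for spot k+1.

allFuns : (m n : ℕ) → List (Vec (Fin n) m)
allFuns zero    n = [] ∷ []
allFuns (suc m) n = concatMap (λ x → map (x ∷_) (allFuns m n)) (allFin n)

-- Parking function: for every i ∈ [n], |{ j : f(j) ≤ i }| ≥ i
-- (0-indexed: for every i < n, |{ j : f j ≤ i }| ≥ i + 1)
isParkingFunction : {n : ℕ} → Vec (Fin n) n → Bool
isParkingFunction {n} f =
  all (λ i → suc i ≤ᵇ length (filter (λ x → T? (toℕ x ≤ᵇ i)) (toList f))) (upTo n)

-- Spots are a vector of Maybe car-labels.
-- parkAt p c s : car c prefers spot p and takes the first free spot ≥ p
-- (if there is none, the car fails to park and s is unchanged).
parkAt : {k : ℕ} → ℕ → ℕ → Vec (Maybe ℕ) k → Vec (Maybe ℕ) k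
parkAt p       c []              = []
parkAt zero    c (nothing ∷ s)   = just c ∷ s
parkAt zero    c (just d ∷ s)    = just d ∷ parkAt zero c s
parkAt (suc p) c (x ∷ s)         = x ∷ parkAt p c s

-- cars 1, …, n arrive in order; car j+1 (label j+1) prefers spot f j
parkAll : {n : ℕ} → Vec (Fin n) n → Vec (Maybe ℕ) n
parkAll {n} f = go 1 (toList f) (replicate n nothing)
  where
  go : ℕ → List (Fin n) → Vec (Maybe ℕ) n → Vec (Maybe ℕ) n
  go c []       s = s
  go c (x ∷ xs) s = go (suc c) xs (parkAt (toℕ x) c s)

catMaybes : List (Maybe ℕ) → List ℕ
catMaybes []             = []
catMaybes (nothing ∷ xs) = catMaybes xs
catMaybes (just x ∷ xs)  = x ∷ catMaybes xs

-- parking permutation ρ_f as the word ρ_f(1) … ρ_f(n)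
-- (for a parking function every spot is occupied, so this has length n)
parkingPermutation : {n : ℕ} → Vec (Fin n) n → List ℕ
parkingPermutation f = catMaybes (toList (parkAll f))

subseqs : {A : Set} → ℕ → List A → List (List A)
subseqs zero    xs       = [] ∷ []
subseqs (suc m) []       = []
subseqs (suc m) (x ∷ xs) = map (x ∷_) (subseqs m xs) Data.List.++ subseqs (suc m) xs

orderIsomorphic : List ℕ → List ℕ → Bool
orderIsomorphic xs σ =
  (length xs ≡ᵇ length σ) ∧
  all (λ p → all (λ q → (Data.Product.proj₁ p <ᵇ Data.Product.proj₁ q)
                        == (Data.Product.proj₂ p <ᵇ Data.Product.proj₂ q)) (zip xs σ)) (zip xs σ)
  where import Data.Product

contains : List ℕ → List ℕ → Bool
contains π σ = any (λ ys → orderIsomorphic ys σ) (subseqs (length σ) π)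

avoids : List ℕ → List ℕ → Bool
avoids π σ = not (contains π σ)

avoidsAll : List ℕ → List (List ℕ) → Bool
avoidsAll π σs = all (avoids π) σs

pk : ℕ → List (List ℕ) → ℕ
pk n σs = length (filter (λ f → T? (isParkingFunction f ∧ avoidsAll (parkingPermutation f) σs))
                         (allFuns n n))

-- The ring ℤ[√2]: a + b√2 represented as (a , b) (unique since √2 ∉ ℚ).
record ℤ√2 : Set where
  constructor _+_√2
  field
    re : ℤ
    im : ℤ

_⊕_ : ℤ√2 → ℤ√2 → ℤ√2
(a + b √2) ⊕ (c + d √2) = (a +ℤ c) + (b +ℤ d) √2

_⊗_ : ℤ√2 → ℤ√2 → ℤ√2
(a + b √2) ⊗ (c + d √2) = (a *ℤ c +ℤ (+ 2) *ℤ (b *ℤ d)) + (a *ℤ d +ℤ b *ℤ c) √2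

_^√_ : ℤ√2 → ℕ → ℤ√2
x ^√ zero  = (+ 1) + (+ 0) √2
x ^√ suc n = x ⊗ (x ^√ n)

ι : ℕ → ℤ√2
ι k = (+ k) + (+ 0) √2

-- Both patterns end with their largest letter, so an occupant sequence avoids them iff no car
-- ends up to the right of two distinct cars that parked before it. Following the cars one at a
-- time, a partial parking is therefore dead once a free spot lies behind two occupied ones, and
-- also once more spots are free than cars remain (a sequence is a parking function exactly when
-- every car parks). The surviving states are a gap of m free spots in front of full ones, with
-- Hₘ completions, or a gap of t spots, one car and a second gap, with 2Hₜ completions. Splitting
-- on the preference of the next car gives Hₘ₊₁ = Hₘ + 2 Σ_{t<m} Hₜ, so Hₙ is the half-companion
-- Pell number ((1+√2)ⁿ + (1−√2)ⁿ)/2.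
{-# OPTIONS --safe #-}
module Submission where

open import Defs
open import Data.Nat using (ℕ; _≤_; _*_)
open import Data.List using (List; []; _∷_)
open import Data.Integer using (+_; -_)
open import Relation.Binary.PropositionalEquality using (_≡_)

open import Data.Bool using (Bool; true; false; T; _∧_; _∨_; not)
open import Data.Bool.ListAction using (all; any)
open import Data.Bool.Properties using (T-≡; T-∧; ∨-assoc; ∨-zeroʳ; ∧-zeroʳ)
open import Data.Empty using (⊥-elim)
open import Data.Fin using (Fin; toℕ)
import Data.Integer as ℤ
open import Data.Integer.Properties using (pos-*; +-inverseˡ)
open import Data.Integer.Solver using (module +-*-Solver)
open import Data.List using (length; _++_; concatMap; tabulate; allFin; filterᵇ)
import Data.List as L
open import Data.List.Membership.Propositional using (_∈_)
open import Data.List.Membership.Propositional.Properties using (∈-upTo⁺)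
open import Data.List.Properties
  using (++-identityʳ; length-replicate; length-++; length-map; filter-++; map-tabulate; tabulate-cong)
open import Data.List.Relation.Binary.Pointwise as Pw using (Pointwise)
open import Data.List.Relation.Binary.Sublist.Heterogeneous as Sub using (Sublist; minimum)
open import Data.List.Relation.Binary.Sublist.Heterogeneous.Properties
  using (fromPointwise; ++ˡ) renaming (trans to Sublist-trans)
open import Data.List.Relation.Binary.Sublist.Propositional using (_⊆_; _∷ʳ_; _∷_)
open import Data.List.Relation.Unary.All as All using (All; []; _∷_)
open import Data.List.Relation.Unary.All.Properties using (all⁺; all⁻; applyUpTo⁺₁)
open import Data.List.Relation.Unary.Any using (here; there)
open import Data.Maybe using (Maybe; just; nothing; is-just)
open import Data.Nat using (zero; suc; _+_; _<_; _<ᵇ_; _≤ᵇ_; z≤n; s≤s)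
open import Data.Nat.Induction using (<-rec)
open import Data.Nat.ListAction using (sum)
open import Data.Nat.Properties
  using (≤-refl; ≤-reflexive; ≤-trans; <-trans; <⇒≢; >⇒≢; <-cmp; <⇒≤; <⇒≱; <⇒≯; <-≤-trans; ≤ᵇ⇒≤; ≤⇒≤ᵇ;
         <ᵇ⇒<; <⇒<ᵇ; n<1+n; m≤n⇒m≤1+n; m<n⇒m<1+n; +-comm; +-assoc; +-identityʳ; +-suc;
         +-monoʳ-≤; +-monoˡ-≤; +-monoʳ-<; *-distribˡ-+; module ≤-Reasoning)
open import Data.Product using (∃-syntax; _×_; _,_; proj₂)
open import Data.Unit using (tt)
open import Data.Vec using (Vec)
import Data.Vec as V
open import Data.Vec.Properties using (length-toList; toList-replicate)
open import Function using (_∘_; id; Equivalence)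
open import Relation.Binary.Definitions using (Trans; tri<; tri≈; tri>)
open import Relation.Binary.PropositionalEquality
  using (_≢_; refl; sym; trans; cong; cong₂; subst; module ≡-Reasoning)
open import Relation.Nullary using (¬_)
open import Relation.Nullary.Decidable using (T?)

iverson : Bool → ℕ
iverson true  = 1
iverson false = 0

iverson≤1 : ∀ b → iverson b ≤ 1
iverson≤1 true  = ≤-refl
iverson≤1 false = z≤n

¬T⇒≡false : ∀ {b} → ¬ T b → b ≡ false
¬T⇒≡false {true}  ¬t = ⊥-elim (¬t tt)
¬T⇒≡false {false} _  = refl

≤ᵇ≡<ᵇsuc : ∀ m n → (m ≤ᵇ n) ≡ (m <ᵇ suc n)
≤ᵇ≡<ᵇsuc zero    n = refl
≤ᵇ≡<ᵇsuc (suc m) n = refl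

<ᵇ-true : ∀ {m n} → m < n → (m <ᵇ n) ≡ true
<ᵇ-true = Equivalence.to T-≡ ∘ <⇒<ᵇ

<ᵇ-false : ∀ {m n} → n ≤ m → (m <ᵇ n) ≡ false
<ᵇ-false n≤m = ¬T⇒≡false λ m<ᵇn → <⇒≱ (<ᵇ⇒< _ _ m<ᵇn) n≤m

<⇒≡+suc : ∀ {i m} → i < m → ∃[ r ] m ≡ i + suc r
<⇒≡+suc {zero}  {suc m} _         = m , refl
<⇒≡+suc {suc i} {suc m} (s≤s i<m) with <⇒≡+suc i<m
... | r , m≡ = r , cong suc m≡

All-<-suc : ∀ {c L} → All (_< c) L → All (_< suc c) L
All-<-suc = All.map m<n⇒m<1+n

countᵇ : {A : Set} → (A → Bool) → List A → ℕ
countᵇ p = length ∘ filterᵇ p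

countᵇ-∷ : ∀ {A : Set} (p : A → Bool) x xs → countᵇ p (x ∷ xs) ≡ iverson (p x) + countᵇ p xs
countᵇ-∷ p x xs with p x
... | true  = refl
... | false = refl

countᵇ-cong : ∀ {A : Set} {p q : A → Bool} → (∀ x → p x ≡ q x) →
  ∀ xs → countᵇ p xs ≡ countᵇ q xs
countᵇ-cong p≗q []       = refl
countᵇ-cong {p = p} {q} p≗q (x ∷ xs) with p x | q x | p≗q x
... | true  | .true  | refl = cong suc (countᵇ-cong p≗q xs)
... | false | .false | refl = countᵇ-cong p≗q xs

countᵇ-map : ∀ {A B : Set} (p : B → Bool) (g : A → B) xs →
  countᵇ p (L.map g xs) ≡ countᵇ (p ∘ g) xs
countᵇ-map p g []       = refl
countᵇ-map p g (x ∷ xs) with p (g x)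
... | true  = cong suc (countᵇ-map p g xs)
... | false = countᵇ-map p g xs

countᵇ-++ : ∀ {A : Set} (p : A → Bool) xs ys → countᵇ p (xs ++ ys) ≡ countᵇ p xs + countᵇ p ys
countᵇ-++ p xs ys = trans (cong length (filter-++ (T? ∘ p) xs ys)) (length-++ (filterᵇ p xs))

countᵇ-concatMap : ∀ {A B : Set} (p : B → Bool) (g : A → List B) xs →
  countᵇ p (concatMap g xs) ≡ sum (L.map (countᵇ p ∘ g) xs)
countᵇ-concatMap p g []       = refl
countᵇ-concatMap p g (x ∷ xs) =
  trans (countᵇ-++ p (g x) (concatMap g xs)) (cong (_+_ (countᵇ p (g x))) (countᵇ-concatMap p g xs))

countᵇ-false : ∀ {A : Set} {p : A → Bool} → (∀ x → p x ≡ false) → ∀ xs → countᵇ p xs ≡ 0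
countᵇ-false p≡false []       = refl
countᵇ-false {p = p} p≡false (x ∷ xs) with p x | p≡false x
... | false | refl = countᵇ-false p≡false xs

any-++ : ∀ {A : Set} (p : A → Bool) xs ys → any p (xs ++ ys) ≡ any p xs ∨ any p ys
any-++ p []       ys = refl
any-++ p (x ∷ xs) ys = trans (cong (p x ∨_) (any-++ p xs ys)) (sym (∨-assoc (p x) _ _))

any-map : ∀ {A B : Set} (p : B → Bool) (g : A → B) xs → any p (L.map g xs) ≡ any (p ∘ g) xs
any-map p g []       = refl
any-map p g (x ∷ xs) = cong (p (g x) ∨_) (any-map p g xs)

any-subseqs-∷ : ∀ {A : Set} (p : List A → Bool) k x xs →
  any p (subseqs (suc k) (x ∷ xs)) ≡ any (p ∘ (x ∷_)) (subseqs k xs) ∨ any p (subseqs (suc k) xs)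
any-subseqs-∷ p k x xs =
  trans (any-++ p (L.map (x ∷_) (subseqs k xs)) (subseqs (suc k) xs))
        (cong (_∨ any p (subseqs (suc k) xs)) (any-map p (x ∷_) (subseqs k xs)))

any-subseqs-⊆ : ∀ {A : Set} (p : List A → Bool) {ys xs} → ys ⊆ xs → p ys ≡ true →
  any p (subseqs (length ys) xs) ≡ true
any-subseqs-⊆ p {[]}              _            pys = cong (_∨ false) pys
any-subseqs-⊆ p {y ∷ ys} {x ∷ xs} (.x ∷ʳ ys⊆)  pys =
  trans (any-subseqs-∷ p (length ys) x xs)
        (trans (cong (any (p ∘ (x ∷_)) (subseqs (length ys) xs) ∨_) (any-subseqs-⊆ p ys⊆ pys))
               (∨-zeroʳ _))
any-subseqs-⊆ p {y ∷ ys} {.y ∷ xs} (refl ∷ ys⊆) pys =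
  trans (any-subseqs-∷ p (length ys) y xs)
        (cong (_∨ any p (subseqs (suc (length ys)) xs)) (any-subseqs-⊆ (p ∘ (y ∷_)) ys⊆ pys))

any-subseqs-All : ∀ {A : Set} {Q : A → Set} (p : List A → Bool) k →
  (∀ ys → length ys ≡ k → All Q ys → p ys ≡ false) →
  ∀ {xs} → All Q xs → any p (subseqs k xs) ≡ false
any-subseqs-All p zero    none _          = cong (_∨ false) (none [] refl [])
any-subseqs-All p (suc k) none []         = refl
any-subseqs-All p (suc k) none {x ∷ xs} (qx ∷ qxs) = trans (any-subseqs-∷ p k x xs) (cong₂ _∨_
  (any-subseqs-All (p ∘ (x ∷_)) k (λ ys len qys → none (x ∷ ys) (cong suc len) (qx ∷ qys)) qxs)
  (any-subseqs-All p (suc k) none qxs))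

Sublist-catMaybes : ∀ {A : Set} {R : A → Maybe ℕ → Set} {xs s} →
  Sublist R xs s → All (T ∘ is-just) s →
  Sublist (λ x v → R x (just v)) xs (catMaybes s)
Sublist-catMaybes Sub.[]                       []         = Sub.[]
Sublist-catMaybes (just v Sub.∷ʳ sub)          (_ ∷ full) = v Sub.∷ʳ Sublist-catMaybes sub full
Sublist-catMaybes (Sub._∷_ {y = just v} r sub) (_ ∷ full) = r Sub.∷ Sublist-catMaybes sub full

Sublist⇒Pointwise-⊆ : ∀ {A B : Set} {R : A → B → Set} {xs ys} → Sublist R xs ys →
  ∃[ zs ] (Pointwise R xs zs × zs ⊆ ys)
Sublist⇒Pointwise-⊆ Sub.[] = [] , Pw.[] , Sub.[]
Sublist⇒Pointwise-⊆ (y Sub.∷ʳ sub) with Sublist⇒Pointwise-⊆ sub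
... | zs , pw , zs⊆ = zs , pw , y ∷ʳ zs⊆
Sublist⇒Pointwise-⊆ (r Sub.∷ sub) with Sublist⇒Pointwise-⊆ sub
... | zs , pw , zs⊆ = _ , r Pw.∷ pw , refl ∷ zs⊆

Σ< : ℕ → (ℕ → ℕ) → ℕ
Σ< zero    h = 0
Σ< (suc n) h = h 0 + Σ< n (h ∘ suc)

syntax Σ< n (λ i → e) = Σ[ i < n ] e

sum-tabulate : ∀ n (h : ℕ → ℕ) → sum (tabulate {n = n} (h ∘ toℕ)) ≡ Σ[ i < n ] h i
sum-tabulate zero    h = refl
sum-tabulate (suc n) h = cong (_+_ (h 0)) (sum-tabulate n (h ∘ suc))

Σ-+ : ∀ a b (h : ℕ → ℕ) → Σ[ i < a + b ] h i ≡ Σ[ i < a ] h i + Σ[ j < b ] h (a + j)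
Σ-+ zero    b h = refl
Σ-+ (suc a) b h = trans (cong (_+_ (h 0)) (Σ-+ a b (h ∘ suc))) (sym (+-assoc (h 0) _ _))

Σ-suc : ∀ a (h : ℕ → ℕ) → Σ[ i < suc a ] h i ≡ Σ[ i < a ] h i + h a
Σ-suc zero    h = +-identityʳ (h 0)
Σ-suc (suc a) h = trans (cong (_+_ (h 0)) (Σ-suc a (h ∘ suc))) (sym (+-assoc (h 0) _ _))

Σ-cong : ∀ n {h g : ℕ → ℕ} → (∀ {i} → i < n → h i ≡ g i) →
  Σ[ i < n ] h i ≡ Σ[ i < n ] g i
Σ-cong zero    h≗g = refl
Σ-cong (suc n) h≗g = cong₂ _+_ (h≗g (s≤s z≤n)) (Σ-cong n (h≗g ∘ s≤s))

Σ-zero : ∀ n {h : ℕ → ℕ} → (∀ {i} → i < n → h i ≡ 0) → Σ[ i < n ] h i ≡ 0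
Σ-zero zero    h≡0 = refl
Σ-zero (suc n) h≡0 = cong₂ _+_ (h≡0 (s≤s z≤n)) (Σ-zero n (h≡0 ∘ s≤s))


-- Parking on lists

Spots : Set
Spots = List (Maybe ℕ)

gap : ℕ → Spots
gap k = L.replicate k nothing

taken : List ℕ → Spots
taken = L.map just

park : ℕ → ℕ → Spots → Spots
park p       c []            = []
park zero    c (nothing ∷ s) = just c ∷ s
park zero    c (just d ∷ s)  = just d ∷ park zero c s
park (suc p) c (x ∷ s)       = x ∷ park p c s

parkFrom : ℕ → List ℕ → Spots → Spots
parkFrom c []       s = s
parkFrom c (p ∷ ps) s = parkFrom (suc c) ps (park p c s)

prefs : ∀ {m n} → Vec (Fin n) m → List ℕ
prefs v = L.map toℕ (V.toList v)

length-park : ∀ p c s → length (park p c s) ≡ length s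
length-park p       c []            = refl
length-park zero    c (nothing ∷ s) = refl
length-park zero    c (just d ∷ s)  = cong suc (length-park zero c s)
length-park (suc p) c (x ∷ s)       = cong suc (length-park p c s)

length-parkFrom : ∀ c ps s → length (parkFrom c ps s) ≡ length s
length-parkFrom c []       s = refl
length-parkFrom c (p ∷ ps) s = trans (length-parkFrom (suc c) ps (park p c s)) (length-park p c s)

length-prefs : ∀ {m n} (v : Vec (Fin n) m) → length (prefs v) ≡ m
length-prefs v = trans (length-map toℕ (V.toList v)) (length-toList v)

toList-parkAt : ∀ {k} p c (s : Vec (Maybe ℕ) k) → V.toList (parkAt p c s) ≡ park p c (V.toList s)
toList-parkAt p       c V.[]            = refl
toList-parkAt zero    c (nothing V.∷ s) = refl
toList-parkAt zero    c (just d V.∷ s)  = cong (just d ∷_) (toList-parkAt zero c s)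
toList-parkAt (suc p) c (x V.∷ s)       = cong (x ∷_) (toList-parkAt p c s)

Loop : ℕ → Set
Loop n = ℕ → List (Fin n) → Vec (Maybe ℕ) n → Vec (Maybe ℕ) n

IsParkingLoop : ∀ {n} → Loop n → Set
IsParkingLoop g =
  (∀ c s → g c [] s ≡ s) × (∀ c x xs s → g c (x ∷ xs) s ≡ g (suc c) xs (parkAt (toℕ x) c s))

toList-loop : ∀ {n} (g : Loop n) → IsParkingLoop g →
  ∀ c xs s → V.toList (g c xs s) ≡ parkFrom c (L.map toℕ xs) (V.toList s)
toList-loop g (g-[] , g-∷) c []       s = cong V.toList (g-[] c s)
toList-loop g (g-[] , g-∷) c (x ∷ xs) s = begin
  V.toList (g c (x ∷ xs) s)
    ≡⟨ cong V.toList (g-∷ c x xs s) ⟩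
  V.toList (g (suc c) xs (parkAt (toℕ x) c s))
    ≡⟨ toList-loop g (g-[] , g-∷) (suc c) xs _ ⟩
  parkFrom (suc c) (L.map toℕ xs) (V.toList (parkAt (toℕ x) c s))
    ≡⟨ cong (parkFrom (suc c) (L.map toℕ xs)) (toList-parkAt (toℕ x) c s) ⟩
  parkFrom c (L.map toℕ (x ∷ xs)) (V.toList s) ∎
  where open ≡-Reasoning

-- `parkAll` runs a loop local to its definition; abstracting its arguments lets unification
-- recover that loop as the witness.
parkAll-loop : ∀ {n} (f : Vec (Fin n) n) →
  ∃[ g ] (IsParkingLoop g × parkAll f ≡ g 1 (V.toList f) (V.replicate n nothing))
parkAll-loop {n} f = loop , ((λ _ _ → refl) , (λ _ _ _ _ → refl)) , unfold
  where
  loop : Loop n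
  loop = _
  unfold : parkAll f ≡ loop 1 (V.toList f) (V.replicate n nothing)
  unfold with V.toList f | 1 | V.replicate {A = Maybe ℕ} n nothing
  ... | _ | _ | _ = refl

toList-parkAll : ∀ {n} (f : Vec (Fin n) n) → V.toList (parkAll f) ≡ parkFrom 1 (prefs f) (gap n)
toList-parkAll {n} f with parkAll-loop f
... | g , isLoop , eq = begin
  V.toList (parkAll f)
    ≡⟨ cong V.toList eq ⟩
  V.toList (g 1 (V.toList f) (V.replicate n nothing))
    ≡⟨ toList-loop g isLoop 1 (V.toList f) _ ⟩
  parkFrom 1 (prefs f) (V.toList (V.replicate n nothing))
    ≡⟨ cong (parkFrom 1 (prefs f)) (toList-replicate n nothing) ⟩
  parkFrom 1 (prefs f) (gap n) ∎
  where open ≡-Reasoning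


-- Parking functions

filled : ℕ → Spots → ℕ
filled zero    s             = 0
filled (suc k) []            = 0
filled (suc k) (nothing ∷ s) = filled k s
filled (suc k) (just _ ∷ s)  = suc (filled k s)

filled-≤ : ∀ k s → filled k s ≤ k
filled-≤ zero    s             = z≤n
filled-≤ (suc k) []            = z≤n
filled-≤ (suc k) (nothing ∷ s) = m≤n⇒m≤1+n (filled-≤ k s)
filled-≤ (suc k) (just _ ∷ s)  = s≤s (filled-≤ k s)

filled-gap : ∀ k m → filled k (gap m) ≡ 0
filled-gap zero    m       = refl
filled-gap (suc k) zero    = refl
filled-gap (suc k) (suc m) = filled-gap k m

filled-full : ∀ k s → T (all is-just s) → k ≤ length s → filled k s ≡ k
filled-full zero    s            _    _        = refl
filled-full (suc k) (just _ ∷ s) full (s≤s k≤) = cong suc (filled-full k s full k≤)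

filled-park-≤ : ∀ k p c s → filled k (park p c s) ≤ filled k s + iverson (p <ᵇ k)
filled-park-≤ zero    p       c s             = z≤n
filled-park-≤ (suc k) p       c []            = z≤n
filled-park-≤ (suc k) zero    c (nothing ∷ s) = ≤-reflexive (+-comm 1 (filled k s))
filled-park-≤ (suc k) zero    c (just _ ∷ s)  =
  s≤s (≤-trans (filled-park-≤ k zero c s) (+-monoʳ-≤ (filled k s) (iverson≤1 (0 <ᵇ k))))
filled-park-≤ (suc k) (suc p) c (nothing ∷ s) = filled-park-≤ k p c s
filled-park-≤ (suc k) (suc p) c (just _ ∷ s)  = s≤s (filled-park-≤ k p c s)

filled-parkFrom-≤ : ∀ k c ps s → filled k (parkFrom c ps s) ≤ filled k s + countᵇ (_<ᵇ k) ps
filled-parkFrom-≤ k c []       s = ≤-reflexive (sym (+-identityʳ _))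
filled-parkFrom-≤ k c (p ∷ ps) s = begin
  filled k (parkFrom (suc c) ps (park p c s))
    ≤⟨ filled-parkFrom-≤ k (suc c) ps (park p c s) ⟩
  filled k (park p c s) + countᵇ (_<ᵇ k) ps
    ≤⟨ +-monoˡ-≤ _ (filled-park-≤ k p c s) ⟩
  filled k s + iverson (p <ᵇ k) + countᵇ (_<ᵇ k) ps
    ≡⟨ +-assoc (filled k s) _ _ ⟩
  filled k s + (iverson (p <ᵇ k) + countᵇ (_<ᵇ k) ps)
    ≡⟨ cong (_+_ (filled k s)) (sym (countᵇ-∷ (_<ᵇ k) p ps)) ⟩
  filled k s + countᵇ (_<ᵇ k) (p ∷ ps) ∎
  where open ≤-Reasoning

data FreeAt : ℕ → Spots → Set where
  here  : ∀ {s} → FreeAt zero (nothing ∷ s)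
  there : ∀ {i x s} → FreeAt i s → FreeAt (suc i) (x ∷ s)

freeAt-< : ∀ {i s} → FreeAt i s → i < length s
freeAt-< here      = s≤s z≤n
freeAt-< (there h) = s≤s (freeAt-< h)

¬full⇒freeAt : ∀ s → all is-just s ≡ false → ∃[ i ] FreeAt i s
¬full⇒freeAt (nothing ∷ s) _ = zero , here
¬full⇒freeAt (just _ ∷ s) ¬full with ¬full⇒freeAt s ¬full
... | i , h = suc i , there h

freeAt-park⁻ : ∀ {i} p c s → FreeAt i (park p c s) → FreeAt i s
freeAt-park⁻ zero    c (nothing ∷ s) (there h) = there h
freeAt-park⁻ zero    c (just _ ∷ s)  (there h) = there (freeAt-park⁻ zero c s h)
freeAt-park⁻ (suc p) c (x ∷ s)       here      = here
freeAt-park⁻ (suc p) c (x ∷ s)       (there h) = there (freeAt-park⁻ p c s h)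

freeAt-parkFrom⁻ : ∀ {i} c ps s → FreeAt i (parkFrom c ps s) → FreeAt i s
freeAt-parkFrom⁻ c []       s h = h
freeAt-parkFrom⁻ c (p ∷ ps) s h = freeAt-park⁻ p c s (freeAt-parkFrom⁻ (suc c) ps (park p c s) h)

-- while spot i stays free, a car preferring a spot up to i parks before it
filled-park-≥ : ∀ i p c s → FreeAt i (park p c s) →
  filled i s + iverson (p <ᵇ suc i) ≤ filled i (park p c s)
filled-park-≥ (suc i) zero    c (nothing ∷ s) (there h) = ≤-reflexive (+-comm (filled i s) 1)
filled-park-≥ (suc i) zero    c (just _ ∷ s)  (there h) = s≤s (filled-park-≥ i zero c s h)
filled-park-≥ zero    zero    c (nothing ∷ s) ()
filled-park-≥ zero    zero    c (just _ ∷ s)  ()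
filled-park-≥ zero    (suc p) c (x ∷ s)       here      = z≤n
filled-park-≥ (suc i) (suc p) c (nothing ∷ s) (there h) = filled-park-≥ i p c s h
filled-park-≥ (suc i) (suc p) c (just _ ∷ s)  (there h) = s≤s (filled-park-≥ i p c s h)

filled-parkFrom-≥ : ∀ i c ps s → FreeAt i (parkFrom c ps s) →
  filled i s + countᵇ (_<ᵇ suc i) ps ≤ filled i (parkFrom c ps s)
filled-parkFrom-≥ i c []       s h = ≤-reflexive (+-identityʳ _)
filled-parkFrom-≥ i c (p ∷ ps) s h = begin
  filled i s + countᵇ (_<ᵇ suc i) (p ∷ ps)
    ≡⟨ cong (_+_ (filled i s)) (countᵇ-∷ (_<ᵇ suc i) p ps) ⟩
  filled i s + (iverson (p <ᵇ suc i) + countᵇ (_<ᵇ suc i) ps) ≡⟨ sym (+-assoc (filled i s) _ _) ⟩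
  filled i s + iverson (p <ᵇ suc i) + countᵇ (_<ᵇ suc i) ps
    ≤⟨ +-monoˡ-≤ _ (filled-park-≥ i p c s (freeAt-parkFrom⁻ (suc c) ps (park p c s) h)) ⟩
  filled i (park p c s) + countᵇ (_<ᵇ suc i) ps
    ≤⟨ filled-parkFrom-≥ i (suc c) ps (park p c s) h ⟩
  filled i (parkFrom (suc c) ps (park p c s)) ∎
  where open ≤-Reasoning

module _ {n : ℕ} (f : Vec (Fin n) n) where

  private
    final : Spots
    final = parkFrom 1 (prefs f) (gap n)

    #prefs≤ : ℕ → ℕ
    #prefs≤ i = countᵇ (λ x → toℕ x ≤ᵇ i) (V.toList f)

    #prefs≤-prefs : ∀ i → #prefs≤ i ≡ countᵇ (_<ᵇ suc i) (prefs f)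
    #prefs≤-prefs i = trans (countᵇ-cong (λ x → ≤ᵇ≡<ᵇsuc (toℕ x) i) (V.toList f))
                            (sym (countᵇ-map (_<ᵇ suc i) toℕ (V.toList f)))

    length-final : length final ≡ n
    length-final = trans (length-parkFrom 1 (prefs f) (gap n)) (length-replicate n)

    full⇒enough : T (all is-just final) → ∀ {i} → i < n → suc i ≤ #prefs≤ i
    full⇒enough full {i} i<n = begin
      suc i
        ≡⟨ sym (filled-full (suc i) final full (subst (suc i ≤_) (sym length-final) i<n)) ⟩
      filled (suc i) final
        ≤⟨ filled-parkFrom-≤ (suc i) 1 (prefs f) (gap n) ⟩
      filled (suc i) (gap n) + countᵇ (_<ᵇ suc i) (prefs f)
        ≡⟨ cong (_+ countᵇ (_<ᵇ suc i) (prefs f)) (filled-gap (suc i) n) ⟩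
      countᵇ (_<ᵇ suc i) (prefs f)
        ≡⟨ sym (#prefs≤-prefs i) ⟩
      #prefs≤ i ∎
      where open ≤-Reasoning

    freeAt⇒few : ∀ {i} → FreeAt i final → #prefs≤ i ≤ i
    freeAt⇒few {i} free = begin
      #prefs≤ i
        ≡⟨ #prefs≤-prefs i ⟩
      countᵇ (_<ᵇ suc i) (prefs f)
        ≡⟨ cong (_+ countᵇ (_<ᵇ suc i) (prefs f)) (sym (filled-gap i n)) ⟩
      filled i (gap n) + countᵇ (_<ᵇ suc i) (prefs f)
        ≤⟨ filled-parkFrom-≥ i 1 (prefs f) (gap n) free ⟩
      filled i final
        ≤⟨ filled-≤ i final ⟩
      i ∎
      where open ≤-Reasoning

  isParkingFunction≡allParked : isParkingFunction f ≡ all is-just (parkFrom 1 (prefs f) (gap n))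
  isParkingFunction≡allParked with all is-just final in eq
  ... | true  = Equivalence.to T-≡
                  (all⁻ _ (applyUpTo⁺₁ id n (≤⇒≤ᵇ ∘ full⇒enough (subst T (sym eq) tt))))
  ... | false with ¬full⇒freeAt final eq
  ...   | i , free = ¬T⇒≡false λ pf →
          <⇒≱ (s≤s (freeAt⇒few free))
              (≤ᵇ⇒≤ _ _ (All.lookup (all⁺ _ _ pf)
                                    (∈-upTo⁺ (subst (i <_) length-final (freeAt-< free)))))


-- Occurrences of 123 and 213

patterns : List (List ℕ)
patterns = (1 ∷ 2 ∷ 3 ∷ []) ∷ (2 ∷ 1 ∷ 3 ∷ []) ∷ []

T-==-true : ∀ {a b} → T (a == b) → T b → T a
T-==-true {true}          _ _ = tt
T-==-true {false} {false} _ ()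

orderIsomorphic-< : ∀ {x z a d} xs σ → (x , a) ∈ L.zip xs σ → (z , d) ∈ L.zip xs σ →
  T (orderIsomorphic xs σ) → a < d → x < z
orderIsomorphic-< xs σ xa∈ zd∈ iso a<d = <ᵇ⇒< _ _ (T-==-true compare (<⇒<ᵇ a<d))
  where
  compare = All.lookup (all⁺ _ _ (All.lookup (all⁺ _ _ (proj₂ (Equivalence.to T-∧ iso))) xa∈)) zd∈

orderIsomorphic-123 : ∀ {x y z} → x < y → y < z →
  orderIsomorphic (x ∷ y ∷ z ∷ []) (1 ∷ 2 ∷ 3 ∷ []) ≡ true
orderIsomorphic-123 {x} {y} {z} x<y y<z
  rewrite <ᵇ-false {x} ≤-refl | <ᵇ-false {y} ≤-refl | <ᵇ-false {z} ≤-refl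
        | <ᵇ-true x<y | <ᵇ-true y<z | <ᵇ-true (<-trans x<y y<z)
        | <ᵇ-false (<⇒≤ x<y) | <ᵇ-false (<⇒≤ y<z) | <ᵇ-false (<⇒≤ (<-trans x<y y<z)) = refl

orderIsomorphic-213 : ∀ {x y z} → y < x → x < z →
  orderIsomorphic (x ∷ y ∷ z ∷ []) (2 ∷ 1 ∷ 3 ∷ []) ≡ true
orderIsomorphic-213 {x} {y} {z} y<x x<z
  rewrite <ᵇ-false {x} ≤-refl | <ᵇ-false {y} ≤-refl | <ᵇ-false {z} ≤-refl
        | <ᵇ-true y<x | <ᵇ-true x<z | <ᵇ-true (<-trans y<x x<z)
        | <ᵇ-false (<⇒≤ y<x) | <ᵇ-false (<⇒≤ x<z) | <ᵇ-false (<⇒≤ (<-trans y<x x<z)) = refl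

contains-max-∷ : ∀ {a b d c L} → a < d → All (_< c) L →
  contains (c ∷ L) (a ∷ b ∷ d ∷ []) ≡ contains L (a ∷ b ∷ d ∷ [])
contains-max-∷ {a} {b} {d} {c} {L} a<d L<c =
  trans (any-subseqs-∷ (λ ys → orderIsomorphic ys σ) 2 c L)
        (cong (_∨ contains L σ) (any-subseqs-All _ 2 noOccurrence L<c))
  where
  σ = a ∷ b ∷ d ∷ []
  noOccurrence : ∀ ys → length ys ≡ 2 → All (_< c) ys → orderIsomorphic (c ∷ ys) σ ≡ false
  noOccurrence (y ∷ z ∷ []) refl (_ ∷ z<c ∷ []) = ¬T⇒≡false λ iso →
    <⇒≯ z<c (orderIsomorphic-< (c ∷ y ∷ z ∷ []) σ (here refl) (there (there (here refl))) iso a<d)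

contains-∷-max-∷ : ∀ {a b d x c L} → a < d → b < d → All (_< c) L →
  contains (x ∷ c ∷ L) (a ∷ b ∷ d ∷ []) ≡ contains (x ∷ L) (a ∷ b ∷ d ∷ [])
contains-∷-max-∷ {a} {b} {d} {x} {c} {L} a<d b<d L<c = begin
  any iso (subseqs 3 (x ∷ c ∷ L))
    ≡⟨ any-subseqs-∷ iso 2 x (c ∷ L) ⟩
  any (iso ∘ (x ∷_)) (subseqs 2 (c ∷ L)) ∨ any iso (subseqs 3 (c ∷ L))
    ≡⟨ cong₂ _∨_ skipC (contains-max-∷ a<d L<c) ⟩
  any (iso ∘ (x ∷_)) (subseqs 2 L) ∨ any iso (subseqs 3 L)
    ≡⟨ any-subseqs-∷ iso 2 x L ⟨
  any iso (subseqs 3 (x ∷ L)) ∎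
  where
  open ≡-Reasoning
  σ = a ∷ b ∷ d ∷ []
  iso : List ℕ → Bool
  iso ys = orderIsomorphic ys σ
  noOccurrence : ∀ ys → length ys ≡ 1 → All (_< c) ys → iso (x ∷ c ∷ ys) ≡ false
  noOccurrence (z ∷ []) refl (z<c ∷ []) = ¬T⇒≡false λ iso →
    <⇒≯ z<c (orderIsomorphic-< (x ∷ c ∷ z ∷ []) σ (there (here refl)) (there (there (here refl)))
                               iso b<d)
  skipC : any (iso ∘ (x ∷_)) (subseqs 2 (c ∷ L)) ≡ any (iso ∘ (x ∷_)) (subseqs 2 L)
  skipC = trans (any-subseqs-∷ (iso ∘ (x ∷_)) 1 c L)
                (cong (_∨ any (iso ∘ (x ∷_)) (subseqs 2 L)) (any-subseqs-All _ 1 noOccurrence L<c))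

avoidsAll-cong : ∀ {π π′ σs} → All (λ σ → contains π σ ≡ contains π′ σ) σs →
  avoidsAll π σs ≡ avoidsAll π′ σs
avoidsAll-cong []         = refl
avoidsAll-cong (eq ∷ eqs) = cong₂ (λ u v → not u ∧ v) eq (avoidsAll-cong eqs)

avoids-max-∷ : ∀ {c L} → All (_< c) L → avoidsAll (c ∷ L) patterns ≡ avoidsAll L patterns
avoids-max-∷ {c} {L} L<c =
  avoidsAll-cong {c ∷ L} {L} {patterns} (contains-max-∷ 1<3 L<c ∷ contains-max-∷ ≤-refl L<c ∷ [])
  where 1<3 = s≤s (s≤s z≤n)

avoids-∷-max-∷ : ∀ {x c L} → All (_< c) L →
  avoidsAll (x ∷ c ∷ L) patterns ≡ avoidsAll (x ∷ L) patterns
avoids-∷-max-∷ {x} {c} {L} L<c =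
  avoidsAll-cong {x ∷ c ∷ L} {x ∷ L} {patterns}
    (contains-∷-max-∷ 1<3 ≤-refl L<c ∷ contains-∷-max-∷ ≤-refl 1<3 L<c ∷ [])
  where 1<3 = s≤s (s≤s z≤n)

avoids-⊆-twoThenLarger : ∀ {a b v π} → (a ∷ b ∷ v ∷ []) ⊆ π → a ≢ b → a < v → b < v →
  avoidsAll π patterns ≡ false
avoids-⊆-twoThenLarger {a} {b} sub a≢b a<v b<v with <-cmp a b
... | tri< a<b _ _ rewrite any-subseqs-⊆ (λ ys → orderIsomorphic ys (1 ∷ 2 ∷ 3 ∷ [])) sub
                                         (orderIsomorphic-123 a<b b<v) = refl
... | tri≈ _ a≡b _ = ⊥-elim (a≢b a≡b)
... | tri> _ _ b<a rewrite any-subseqs-⊆ (λ ys → orderIsomorphic ys (2 ∷ 1 ∷ 3 ∷ [])) sub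
                                         (orderIsomorphic-213 b<a a<v) = ∧-zeroʳ _


-- Counting completions of a partial parking

succeeds : Spots → ℕ → List ℕ → Bool
succeeds s c ps = all is-just (parkFrom c ps s) ∧ avoidsAll (catMaybes (parkFrom c ps s)) patterns

extensions : ℕ → Spots → ℕ → ℕ → ℕ
extensions n s c m = countᵇ (λ (v : Vec (Fin n) m) → succeeds s c (prefs v)) (allFuns m n)

pk≡extensions : ∀ n → pk n patterns ≡ extensions n (gap n) 1 n
pk≡extensions n = countᵇ-cong same (allFuns n n)
  where
  same : ∀ f →
    isParkingFunction f ∧ avoidsAll (parkingPermutation f) patterns ≡ succeeds (gap n) 1 (prefs f)
  same f = cong₂ (λ full spots → full ∧ avoidsAll (catMaybes spots) patterns)
                 (isParkingFunction≡allParked f) (toList-parkAll f)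

extensions-suc : ∀ n s c m → extensions n s c (suc m) ≡ Σ[ p < n ] extensions n (park p c s) (suc c) m
extensions-suc n s c m = begin
  extensions n s c (suc m)
    ≡⟨ countᵇ-concatMap succeeds′ (λ x → L.map (x V.∷_) (allFuns m n)) (allFin n) ⟩
  sum (L.map startingWith (allFin n))
    ≡⟨ cong sum (map-tabulate id startingWith) ⟩
  sum (tabulate {n = n} startingWith)
    ≡⟨ cong sum (tabulate-cong (λ x → countᵇ-map succeeds′ (x V.∷_) (allFuns m n))) ⟩
  sum (tabulate {n = n} (λ x → extensions n (park (toℕ x) c s) (suc c) m))
    ≡⟨ sum-tabulate n (λ p → extensions n (park p c s) (suc c) m) ⟩
  Σ[ p < n ] extensions n (park p c s) (suc c) m ∎
  where
  open ≡-Reasoning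
  succeeds′ : Vec (Fin n) (suc m) → Bool
  succeeds′ v = succeeds s c (prefs v)
  startingWith : Fin n → ℕ
  startingWith x = countᵇ succeeds′ (L.map (x V.∷_) (allFuns m n))

all-taken : ∀ L → all is-just (taken L) ≡ true
all-taken []      = refl
all-taken (_ ∷ L) = all-taken L

catMaybes-taken : ∀ L → catMaybes (taken L) ≡ L
catMaybes-taken []      = refl
catMaybes-taken (x ∷ L) = cong (x ∷_) (catMaybes-taken L)

extensions-taken : ∀ n c L → avoidsAll L patterns ≡ true → extensions n (taken L) c 0 ≡ 1
extensions-taken n c L avoids rewrite all-taken L | catMaybes-taken L | avoids = refl

vacancies : Spots → ℕ
vacancies []            = 0
vacancies (nothing ∷ s) = suc (vacancies s)
vacancies (just _ ∷ s)  = vacancies s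

vacancies-park : ∀ p c s → vacancies s ≤ suc (vacancies (park p c s))
vacancies-park p       c []            = z≤n
vacancies-park zero    c (nothing ∷ s) = ≤-refl
vacancies-park zero    c (just _ ∷ s)  = vacancies-park zero c s
vacancies-park (suc p) c (nothing ∷ s) = s≤s (vacancies-park p c s)
vacancies-park (suc p) c (just _ ∷ s)  = vacancies-park p c s

vacancies-parkFrom : ∀ c ps s → vacancies s ≤ length ps + vacancies (parkFrom c ps s)
vacancies-parkFrom c []       s = ≤-refl
vacancies-parkFrom c (p ∷ ps) s =
  ≤-trans (vacancies-park p c s) (s≤s (vacancies-parkFrom (suc c) ps (park p c s)))

vacancies-full : ∀ s → T (all is-just s) → vacancies s ≡ 0
vacancies-full []           _    = refl
vacancies-full (just _ ∷ s) full = vacancies-full s full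

extensions-overfull : ∀ n s c m → m < vacancies s → extensions n s c m ≡ 0
extensions-overfull n s c m m<vacancies = countᵇ-false fails (allFuns m n)
  where
  fails : ∀ v → succeeds s c (prefs v) ≡ false
  fails v with all is-just (parkFrom c (prefs v) s) in full
  ... | false = refl
  ... | true  = ⊥-elim (<⇒≱ m<vacancies (begin
    vacancies s
      ≤⟨ vacancies-parkFrom c (prefs v) s ⟩
    length (prefs v) + vacancies (parkFrom c (prefs v) s)
      ≡⟨ cong₂ _+_ (length-prefs v) (vacancies-full (parkFrom c (prefs v) s) (subst T (sym full) tt)) ⟩
    m + 0
      ≡⟨ +-identityʳ m ⟩
    m ∎))
    where open ≤-Reasoning

data Refines (c : ℕ) : Maybe ℕ → Maybe ℕ → Set where
  kept   : ∀ {x} → Refines c x x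
  parked : ∀ {v} → c ≤ v → Refines c nothing (just v)

refines-trans : ∀ {c} → Trans (Refines c) (Refines c) (Refines c)
refines-trans kept         r    = r
refines-trans (parked c≤v) kept = parked c≤v

park-refines : ∀ {c c′} → c ≤ c′ → ∀ p s → Pointwise (Refines c) s (park p c′ s)
park-refines c≤c′ p       []            = Pw.[]
park-refines c≤c′ zero    (nothing ∷ s) = parked c≤c′ Pw.∷ Pw.refl kept
park-refines c≤c′ zero    (just _ ∷ s)  = kept Pw.∷ park-refines c≤c′ zero s
park-refines c≤c′ (suc p) (x ∷ s)       = kept Pw.∷ park-refines c≤c′ p s

parkFrom-refines : ∀ {c c′} → c ≤ c′ → ∀ ps s → Pointwise (Refines c) s (parkFrom c′ ps s)
parkFrom-refines c≤c′ []       s = Pw.refl kept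
parkFrom-refines c≤c′ (p ∷ ps) s = Pw.transitive refines-trans
  (park-refines c≤c′ p s) (parkFrom-refines (m≤n⇒m≤1+n c≤c′) ps (park p _ s))

-- The `nothing` of the pattern matches a spot that is free or taken by a car labelled c or more.
Doomed : ℕ → ℕ → ℕ → Spots → Set
Doomed a b c = Sublist (Refines c) (just a ∷ just b ∷ nothing ∷ [])

doomed-full : ∀ {a b c s} → Doomed a b c s → T (all is-just s) →
  ∃[ v ] (c ≤ v × (a ∷ b ∷ v ∷ []) ⊆ catMaybes s)
doomed-full doomed full with Sublist⇒Pointwise-⊆ (Sublist-catMaybes doomed (all⁺ _ _ full))
... | _ , kept Pw.∷ kept Pw.∷ parked c≤v Pw.∷ Pw.[] , sub = _ , c≤v , sub

extensions-doomed : ∀ {a b} n s c m → a ≢ b → a < c → b < c → Doomed a b c s →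
  extensions n s c m ≡ 0
extensions-doomed n s c m a≢b a<c b<c doomed = countᵇ-false fails (allFuns m n)
  where
  fails : ∀ v → succeeds s c (prefs v) ≡ false
  fails v with all is-just (parkFrom c (prefs v) s) in full
  ... | false = refl
  ... | true with doomed-full
                    (Sublist-trans refines-trans doomed (fromPointwise (parkFrom-refines ≤-refl (prefs v) s)))
                    (subst T (sym full) tt)
  ...   | _ , c≤v , sub = avoids-⊆-twoThenLarger sub a≢b (<-≤-trans a<c c≤v) (<-≤-trans b<c c≤v)


-- Cars arriving at a gap

park-gap-++ : ∀ k i c Z → park (k + i) c (gap k ++ Z) ≡ gap k ++ park i c Z
park-gap-++ zero    i c Z = refl
park-gap-++ (suc k) i c Z = cong (nothing ∷_) (park-gap-++ k i c Z)

park-taken : ∀ i c L → park i c (taken L) ≡ taken L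
park-taken i       c []      = refl
park-taken zero    c (x ∷ L) = cong (just x ∷_) (park-taken zero c L)
park-taken (suc i) c (x ∷ L) = cong (just x ∷_) (park-taken i c L)

park-past-gap : ∀ k j c L → park (k + j) c (gap k ++ taken L) ≡ gap k ++ taken L
park-past-gap k j c L = trans (park-gap-++ k j c (taken L)) (cong (gap k ++_) (park-taken j c L))

park-into-gap : ∀ i r c Z → park i c (gap (suc i + r) ++ Z) ≡ gap i ++ just c ∷ gap r ++ Z
park-into-gap zero    r c Z = refl
park-into-gap (suc i) r c Z = cong (nothing ∷_) (park-into-gap i r c Z)

park-end-of-gap : ∀ i c Z → park i c (gap (suc i) ++ Z) ≡ gap i ++ just c ∷ Z
park-end-of-gap zero    c Z = refl
park-end-of-gap (suc i) c Z = cong (nothing ∷_) (park-end-of-gap i c Z)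

vacancies-gap-++ : ∀ k s → vacancies (gap k ++ s) ≡ k + vacancies s
vacancies-gap-++ zero    s = refl
vacancies-gap-++ (suc k) s = cong suc (vacancies-gap-++ k s)

vacancies-gap-taken : ∀ k L → vacancies (gap k ++ taken L) ≡ k
vacancies-gap-taken k L =
  trans (vacancies-gap-++ k (taken L)) (trans (cong (_+_ k) (vacancies-taken L)) (+-identityʳ k))
  where
  vacancies-taken : ∀ L → vacancies (taken L) ≡ 0
  vacancies-taken []      = refl
  vacancies-taken (_ ∷ L) = vacancies-taken L

Sublist-park-before : ∀ {d xs Z p t} c → p < t → Sublist (Refines d) xs Z →
  Sublist (Refines d) (just c ∷ xs) (park p c (gap t ++ Z))
Sublist-park-before {p = zero}  {suc t} c _         sub = kept Sub.∷ ++ˡ (gap t) sub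
Sublist-park-before {p = suc p} {suc t} c (s≤s p<t) sub = nothing Sub.∷ʳ Sublist-park-before c p<t sub

Sublist-park-before-free : ∀ {d Z p t} c → p < t →
  Sublist (Refines d) (just c ∷ nothing ∷ []) (park p c (gap (suc t) ++ Z))
Sublist-park-before-free {p = zero}  {suc t} c _         = kept Sub.∷ kept Sub.∷ minimum _
Sublist-park-before-free {p = suc p} {suc t} c (s≤s p<t) = nothing Sub.∷ʳ Sublist-park-before-free c p<t


-- The Pell recurrence

-- (1 + √2)ⁿ = Hₙ + Pₙ √2 with Pₙ the Pell numbers
mutual
  H : ℕ → ℕ
  H zero    = 1
  H (suc m) = H m + 2 * P m

  P : ℕ → ℕ
  P zero    = 0
  P (suc m) = H m + P m

2P≡Σ2H : ∀ m → 2 * P m ≡ Σ[ p < m ] (2 * H p)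
2P≡Σ2H zero    = refl
2P≡Σ2H (suc m) = begin
  2 * (H m + P m)                  ≡⟨ *-distribˡ-+ 2 (H m) (P m) ⟩
  2 * H m + 2 * P m                ≡⟨ +-comm (2 * H m) _ ⟩
  2 * P m + 2 * H m                ≡⟨ cong (_+ 2 * H m) (2P≡Σ2H m) ⟩
  Σ[ p < m ] (2 * H p) + 2 * H m     ≡⟨ Σ-suc m (λ p → 2 * H p) ⟨
  Σ[ p < suc m ] (2 * H p)           ∎
  where open ≡-Reasoning

H-suc : ∀ m → H (suc m) ≡ Σ[ p < m ] (2 * H p) + H m
H-suc m = trans (+-comm (H m) (2 * P m)) (cong (_+ H m) (2P≡Σ2H m))

GapCount : ℕ → Set
GapCount m = ∀ {n c L} → n ≡ m + length L → All (_< c) L → avoidsAll L patterns ≡ true →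
  extensions n (gap m ++ taken L) c m ≡ H m

extensions-split-gap-sum : ∀ t u {n a c L} → n ≡ t + suc (suc u + length L) → a < c →
  let W = gap (suc u) ++ taken L
      F = λ i → extensions n (gap t ++ just a ∷ park i c W) (suc c) (t + u)
  in extensions n (gap t ++ just a ∷ W) c (t + suc u) ≡ F 0 + F u
extensions-split-gap-sum t u {n} {a} {c} {L} n≡ a<c = begin
  extensions n s c (t + suc u)
    ≡⟨ cong (extensions n s c) (+-suc t u) ⟩
  extensions n s c (suc (t + u))
    ≡⟨ extensions-suc n s c (t + u) ⟩
  Σ[ p < n ] G p
    ≡⟨ cong (λ k → Σ< k G) n≡ ⟩
  Σ[ p < t + suc (suc u + l) ] G p
    ≡⟨ Σ-+ t (suc (suc u + l)) G ⟩
  Σ[ p < t ] G p + Σ[ i < suc (suc u + l) ] G (t + i)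
    ≡⟨ cong₂ _+_ (Σ-zero t beforeA) (Σ-cong (suc (suc u + l)) behindA) ⟩
  F 0 + Σ[ i < suc u + l ] F i
    ≡⟨ cong (_+_ (F 0)) (Σ-+ (suc u) l F) ⟩
  F 0 + (Σ[ i < suc u ] F i + Σ[ j < l ] F (suc u + j))
    ≡⟨ cong (_+_ (F 0)) (cong₂ _+_ (Σ-suc u F) (Σ-zero l pastGap)) ⟩
  F 0 + (Σ[ i < u ] F i + F u + 0)
    ≡⟨ cong (λ x → F 0 + (x + F u + 0)) (Σ-zero u inGap) ⟩
  F 0 + (F u + 0)
    ≡⟨ cong (_+_ (F 0)) (+-identityʳ (F u)) ⟩
  F 0 + F u ∎
  where
  open ≡-Reasoning
  l = length L
  W = gap (suc u) ++ taken L
  s = gap t ++ just a ∷ W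
  G : ℕ → ℕ
  G p = extensions n (park p c s) (suc c) (t + u)
  F : ℕ → ℕ
  F i = extensions n (gap t ++ just a ∷ park i c W) (suc c) (t + u)
  beforeA : ∀ {p} → p < t → G p ≡ 0
  beforeA p<t = extensions-doomed n _ (suc c) (t + u) (>⇒≢ a<c) (n<1+n c) (m<n⇒m<1+n a<c)
    (Sublist-park-before c p<t (kept Sub.∷ kept Sub.∷ minimum _))
  behindA : ∀ {i} → i < suc (suc u + l) →
    G (t + i) ≡ extensions n (gap t ++ park i c (just a ∷ W)) (suc c) (t + u)
  behindA {i} _ = cong (λ s′ → extensions n s′ (suc c) (t + u)) (park-gap-++ t i c (just a ∷ W))
  inGap : ∀ {i} → i < u → F i ≡ 0
  inGap i<u = extensions-doomed n _ (suc c) (t + u) (<⇒≢ a<c) (m<n⇒m<1+n a<c) (n<1+n c)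
    (++ˡ (gap t) (kept Sub.∷ Sublist-park-before-free c i<u))
  pastGap : ∀ {j} → j < l → F (suc u + j) ≡ 0
  pastGap {j} _ =
    trans (cong (λ w → extensions n (gap t ++ just a ∷ w) (suc c) (t + u)) (park-past-gap (suc u) j c L))
    (extensions-overfull n s (suc c) (t + u)
      (subst (t + u <_)
             (sym (trans (vacancies-gap-++ t (just a ∷ W)) (cong (_+_ t) (vacancies-gap-taken (suc u) L))))
             (+-monoʳ-< t (n<1+n u))))

extensions-split-gap : ∀ {t} → GapCount t → ∀ u {n a c L} → n ≡ t + suc (suc u + length L) →
  a < c → All (_< c) L → avoidsAll (a ∷ L) patterns ≡ true →
  extensions n (gap t ++ just a ∷ gap (suc u) ++ taken L) c (t + suc u) ≡ 2 * H t
extensions-split-gap {t} gapCount zero {n} {a} {c} {L} n≡ a<c L<c avoids = begin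
  extensions n (gap t ++ just a ∷ gap 1 ++ taken L) c (t + 1)
    ≡⟨ extensions-split-gap-sum t 0 n≡ a<c ⟩
  F + F
    ≡⟨ cong₂ _+_ closesGap closesGap ⟩
  H t + H t
    ≡⟨ cong (_+_ (H t)) (+-identityʳ (H t)) ⟨
  2 * H t ∎
  where
  open ≡-Reasoning
  F = extensions n (gap t ++ just a ∷ just c ∷ taken L) (suc c) (t + 0)
  closesGap : F ≡ H t
  closesGap = trans (cong (extensions n _ (suc c)) (+-identityʳ t))
    (gapCount n≡ (m<n⇒m<1+n a<c ∷ n<1+n c ∷ All-<-suc L<c) (trans (avoids-∷-max-∷ L<c) avoids))
extensions-split-gap {t} gapCount (suc u) {n} {a} {c} {L} n≡ a<c L<c avoids = begin
  extensions n (gap t ++ just a ∷ W) c (t + suc (suc u))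
    ≡⟨ extensions-split-gap-sum t (suc u) n≡ a<c ⟩
  F 0 + F (suc u)
    ≡⟨ cong₂ _+_ doomed shorterGap ⟩
  2 * H t ∎
  where
  open ≡-Reasoning
  W = gap (suc (suc u)) ++ taken L
  F : ℕ → ℕ
  F i = extensions n (gap t ++ just a ∷ park i c W) (suc c) (t + suc u)
  doomed : F 0 ≡ 0
  doomed = extensions-doomed n _ (suc c) (t + suc u) (<⇒≢ a<c) (m<n⇒m<1+n a<c) (n<1+n c)
    (++ˡ (gap t) (kept Sub.∷ kept Sub.∷ kept Sub.∷ minimum _))
  shorterGap : F (suc u) ≡ 2 * H t
  shorterGap = trans
    (cong (λ w → extensions n (gap t ++ just a ∷ w) (suc c) (t + suc u)) (park-end-of-gap (suc u) c (taken L)))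
    (extensions-split-gap gapCount u (trans n≡ (cong (λ k → t + suc k) (sym (+-suc (suc u) (length L)))))
      (m<n⇒m<1+n a<c) (n<1+n c ∷ All-<-suc L<c) (trans (avoids-∷-max-∷ L<c) avoids))

extensions-park-in-gap : ∀ {m p n c L} → p < m → GapCount p → n ≡ suc m + length L →
  All (_< c) L → avoidsAll L patterns ≡ true →
  extensions n (park p c (gap (suc m) ++ taken L)) (suc c) m ≡ 2 * H p
extensions-park-in-gap {p = p} {n} {c} {L} p<m gapCount n≡ L<c avoids with <⇒≡+suc p<m
... | r , refl = trans
  (cong (λ s → extensions n s (suc c) (p + suc r)) (park-into-gap p (suc r) c (taken L)))
  (extensions-split-gap gapCount r (trans n≡ (arithmetic p r (length L))) (n<1+n c) (All-<-suc L<c)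
    (trans (avoids-max-∷ L<c) avoids))
  where
  arithmetic : ∀ p r l → suc (p + suc r) + l ≡ p + suc (suc r + l)
  arithmetic p r l = trans (cong suc (+-assoc p (suc r) l)) (sym (+-suc p (suc r + l)))

extensions-park-end-of-gap : ∀ {m n c L} → GapCount m → n ≡ suc m + length L →
  All (_< c) L → avoidsAll L patterns ≡ true →
  extensions n (park m c (gap (suc m) ++ taken L)) (suc c) m ≡ H m
extensions-park-end-of-gap {m} {n} {c} {L} gapCount n≡ L<c avoids =
  trans (cong (λ s → extensions n s (suc c) m) (park-end-of-gap m c (taken L)))
    (gapCount (trans n≡ (sym (+-suc m (length L)))) (n<1+n c ∷ All-<-suc L<c)
              (trans (avoids-max-∷ L<c) avoids))

gap-count : ∀ m → GapCount m
gap-count = <-rec GapCount step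
  where
  step : ∀ m → (∀ {x} → x < m → GapCount x) → GapCount m
  step zero    _  {n} {c} {L} _  _   avoids = extensions-taken n c L avoids
  step (suc m) IH {n} {c} {L} n≡ L<c avoids = begin
    extensions n s c (suc m)                           ≡⟨ extensions-suc n s c m ⟩
    Σ[ p < n ] G p                                     ≡⟨ cong (λ k → Σ< k G) n≡ ⟩
    Σ[ p < suc m + l ] G p                             ≡⟨ Σ-+ (suc m) l G ⟩
    Σ[ p < suc m ] G p + Σ[ j < l ] G (suc m + j)      ≡⟨ cong₂ _+_ (Σ-suc m G) (Σ-zero l pastGap) ⟩
    Σ[ p < m ] G p + G m + 0                           ≡⟨ +-identityʳ _ ⟩
    Σ[ p < m ] G p + G m                               ≡⟨ cong₂ _+_ (Σ-cong m inGap) endOfGap ⟩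
    Σ[ p < m ] (2 * H p) + H m                         ≡⟨ H-suc m ⟨
    H (suc m)                                          ∎
    where
    open ≡-Reasoning
    l = length L
    s = gap (suc m) ++ taken L
    G : ℕ → ℕ
    G p = extensions n (park p c s) (suc c) m
    pastGap : ∀ {j} → j < l → G (suc m + j) ≡ 0
    pastGap {j} _ = trans (cong (λ s′ → extensions n s′ (suc c) m) (park-past-gap (suc m) j c L))
      (extensions-overfull n s (suc c) m (subst (m <_) (sym (vacancies-gap-taken (suc m) L)) (n<1+n m)))
    inGap : ∀ {p} → p < m → G p ≡ 2 * H p
    inGap p<m = extensions-park-in-gap p<m (IH (m<n⇒m<1+n p<m)) n≡ L<c avoids
    endOfGap : G m ≡ H m
    endOfGap = extensions-park-end-of-gap (IH (n<1+n m)) n≡ L<c avoids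

pk-123-213 : ∀ n → pk n patterns ≡ H n
pk-123-213 n = begin
  pk n patterns                          ≡⟨ pk≡extensions n ⟩
  extensions n (gap n) 1 n               ≡⟨ cong (λ s → extensions n s 1 n) (++-identityʳ (gap n)) ⟨
  extensions n (gap n ++ taken []) 1 n   ≡⟨ gap-count n (sym (+-identityʳ n)) [] refl ⟩
  H n                                    ∎
  where open ≡-Reasoning


-- The closed form

pos-+2* : ∀ h p → + h ℤ.+ + 2 ℤ.* + p ≡ + (h + 2 * p)
pos-+2* h p = cong (ℤ._+_ (+ h)) (sym (pos-* 2 p))

module _ where
  open +-*-Solver

  pow-1+√2 : ∀ n → ((+ 1) + (+ 1) √2) ^√ n ≡ (+ H n) + (+ P n) √2
  pow-1+√2 zero    = refl
  pow-1+√2 (suc n) rewrite pow-1+√2 n =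
    cong₂ _+_√2 (trans (re (+ H n) (+ P n)) (pos-+2* (H n) (P n))) (im (+ H n) (+ P n))
    where
    re : ∀ h p → + 1 ℤ.* h ℤ.+ + 2 ℤ.* (+ 1 ℤ.* p) ≡ h ℤ.+ + 2 ℤ.* p
    re = solve 2 (λ h p → con (+ 1) :* h :+ con (+ 2) :* (con (+ 1) :* p) := h :+ con (+ 2) :* p) refl
    im : ∀ h p → + 1 ℤ.* p ℤ.+ + 1 ℤ.* h ≡ h ℤ.+ p
    im = solve 2 (λ h p → con (+ 1) :* p :+ con (+ 1) :* h := h :+ p) refl

  pow-1-√2 : ∀ n → ((+ 1) + (- (+ 1)) √2) ^√ n ≡ (+ H n) + (- (+ P n)) √2
  pow-1-√2 zero    = refl
  pow-1-√2 (suc n) rewrite pow-1-√2 n =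
    cong₂ _+_√2 (trans (re (+ H n) (+ P n)) (pos-+2* (H n) (P n))) (im (+ H n) (+ P n))
    where
    re : ∀ h p → + 1 ℤ.* h ℤ.+ + 2 ℤ.* (- + 1 ℤ.* - p) ≡ h ℤ.+ + 2 ℤ.* p
    re = solve 2 (λ h p → con (+ 1) :* h :+ con (+ 2) :* (con (- + 1) :* (:- p)) := h :+ con (+ 2) :* p) refl
    im : ∀ h p → + 1 ℤ.* - p ℤ.+ - + 1 ℤ.* h ≡ - (h ℤ.+ p)
    im = solve 2 (λ h p → con (+ 1) :* (:- p) :+ con (- + 1) :* h := :- (h :+ p)) refl

2H≡conjugate-powers : ∀ n →
  ι (2 * H n) ≡ (((+ 1) + (- (+ 1)) √2) ^√ n) ⊕ (((+ 1) + (+ 1) √2) ^√ n)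
2H≡conjugate-powers n rewrite pow-1-√2 n | pow-1+√2 n =
  cong₂ _+_√2 (cong +_ (cong (_+_ (H n)) (+-identityʳ (H n)))) (sym (+-inverseˡ (+ P n)))

mainTheorem11 : (n : ℕ) → 1 ≤ n →
    ι (2 * pk n ((1 ∷ 2 ∷ 3 ∷ []) ∷ (2 ∷ 1 ∷ 3 ∷ []) ∷ []))
      ≡ (((+ 1) + (- (+ 1)) √2) ^√ n) ⊕ (((+ 1) + (+ 1) √2) ^√ n)
mainTheorem11 n _ = trans (cong (λ k → ι (2 * k)) (pk-123-213 n)) (2H≡conjugate-powers n)
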